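{- Let $d\ge1$ be an integer, let $F$ be a rooted forest of depth at most $d$, let $L$ be a language, let $\varphi(x_1,\ldots,x_n)$ be a quantifier-free $L$-formula, let $S$ be an $L$-structure guarded by the closure of $F$, and let $v_1,\ldots,v_n\in V(S)$. Then there exists a $\varphi$-template $T$ of depth at most $d$ such that $v_1,\ldots,v_n$ are compatible with $T$, $F$ and $S$.
   Context: A language $L$ has finitely many relation symbols (with arities) and finitely many unary function symbols; an $L$-structure $S$ has a finite domain $V(S)$, relations $R^S$ and functions $f^S:V(S)\to V(S)$. $L$-terms are variables or $f(t)$ for a function symbol $f$ and term $t$; a term $t$ appears in a term $t'$ if $t=t'$ or $t'=f(t'')$ with $t$ appearing in $t''$; a term appears in a formula if it appears in a term of one of its atomic subformulas. The Gaifman graph of $S$ has vertex set $V(S)$, distinct $a,b$ adjacent iff they occur together in a tuple of some relation or one is the image of the other under some $f^S$; $S$ is guarded by a graph $G$ if $V(G)=V(S)$ and the Gaifman graph is a subgraph of $G$. A rooted forest is a digraph whose weak components are out-branchings; depth of a vertex = number of vertices on the path from its root to it; depth of the forest = maximum depth. A subforest of $F$ is a subgraph $F'$ such that for each vertex $v$ of $F'$ the path from the root of $v$'s tree to $v$ lies in $F'$. The closure of $F$ is the undirected graph on $V(F)$ joining distinct vertices connected by a directed path in $F$. For a set $X$ of terms, an $X$-template is a rooted forest $T$ with a map $\alpha_T:X\to V(T)$ such that every vertex of $T$ without descendants is in the image of $\alpha_T$; a $\varphi$-template is an $X$-template where $X$ is the set of all terms appearing in $\varphi$. An embedding of $T$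 in $F$ is a map $\nu:V(T)\to V(F)$ sending roots of $T$ to roots of $F$ that is an isomorphism of $T$ onto the subforest of $F$ with vertex set $\nu(V(T))$. If $X$ has variables among $x_1,\ldots,x_n$ and $v_1,\ldots,v_n\in V(S)$, the embedding is $(v_1,\ldots,v_n)$-admissible for $S$ if $\nu(\alpha_T(t))=t(v_1,\ldots,v_n)$ (the value of $t$ in $S$ with $x_i\mapsto v_i$) for every $t\in X$; $v_1,\ldots,v_n$ are compatible with $T,F,S$ if such an admissible embedding exists. -}

module Defs where

open import Data.Nat using (ℕ; zero; suc; _≤_)
open import Data.Fin using (Fin)
open import Data.Maybe using (Maybe; just; nothing)
open import Data.Bool using (Bool; true)
open import Data.Product using (Σ; ∃; ∃-syntax; _×_; _,_)
open import Data.Sum using (_⊎_)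
open import Relation.Binary.PropositionalEquality using (_≡_; _≢_)
open import Relation.Nullary using (¬_)

record Language : Set where
  field
    nRel  : ℕ
    arity : Fin nRel → ℕ
    nFun  : ℕ
open Language public

-- L-terms with variables among x_1..x_n (variable x_{i+1} is `var i`)
data Term (L : Language) (n : ℕ) : Set where
  var : Fin n → Term L n
  app : Fin (nFun L) → Term L n → Term L n

data Formula (L : Language) (n : ℕ) : Set where
  relF  : (r : Fin (nRel L)) → (Fin (arity L r) → Term L n) → Formula L n
  eqF   : Term L n → Term L n → Formula L n
  trueF : Formula L n
  falseF : Formula L n
  notF  : Formula L n → Formula L n
  andF  : Formula L n → Formula L n → Formula L n
  orF   : Formula L n → Formula L n → Formula L n

data AppearsInTerm {L : Language} {n : ℕ} (t : Term L n) : Term L n → Set where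
  here  : AppearsInTerm t t
  under : ∀ f {t''} → AppearsInTerm t t'' → AppearsInTerm t (app f t'')

data Appears {L : Language} {n : ℕ} (t : Term L n) : Formula L n → Set where
  inRel  : ∀ r ts i → AppearsInTerm t (ts i) → Appears t (relF r ts)
  inEqˡ  : ∀ s u → AppearsInTerm t s → Appears t (eqF s u)
  inEqʳ  : ∀ s u → AppearsInTerm t u → Appears t (eqF s u)
  inNot  : ∀ ψ → Appears t ψ → Appears t (notF ψ)
  inAndˡ : ∀ ψ χ → Appears t ψ → Appears t (andF ψ χ)
  inAndʳ : ∀ ψ χ → Appears t χ → Appears t (andF ψ χ)
  inOrˡ  : ∀ ψ χ → Appears t ψ → Appears t (orF ψ χ)
  inOrʳ  : ∀ ψ χ → Appears t χ → Appears t (orF ψ χ)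

record Structure (L : Language) (N : ℕ) : Set where
  field
    rel : (r : Fin (nRel L)) → (Fin (arity L r) → Fin N) → Bool
    fun : Fin (nFun L) → Fin N → Fin N
open Structure public

eval : ∀ {L N n} → Structure L N → (Fin n → Fin N) → Term L n → Fin N
eval S v (var i)   = v i
eval S v (app f t) = fun S f (eval S v t)

GaifmanAdj : ∀ {L N} → Structure L N → Fin N → Fin N → Set
GaifmanAdj {L} {N} S a b =
  a ≢ b ×
  ( (Σ (Fin (nRel L)) λ r → Σ (Fin (arity L r) → Fin N) λ tup →
       rel S r tup ≡ true × (∃[ i ] ∃[ j ] (tup i ≡ a × tup j ≡ b)))
  ⊎ (∃[ f ] (fun S f a ≡ b ⊎ fun S f b ≡ a)))

-- Rooted forests, given by their (partial) parent function: the arc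
-- set is { parent v → v }.  Every vertex has in-degree ≤ 1, and
-- acyclicity makes every weak component an out-branching.

data StrictAnc {M : ℕ} (p : Fin M → Maybe (Fin M)) : Fin M → Fin M → Set where
  parentOf : ∀ {u v} → p v ≡ just u → StrictAnc p u v
  step     : ∀ {u w v} → p v ≡ just w → StrictAnc p u w → StrictAnc p u v

record Forest (M : ℕ) : Set where
  field
    parent  : Fin M → Maybe (Fin M)
    acyclic : ∀ v → ¬ StrictAnc parent v v
open Forest public

-- Depth F v k : the path from the root of v's tree to v has k vertices
data Depth {M : ℕ} (F : Forest M) : Fin M → ℕ → Set where
  root  : ∀ {v} → parent F v ≡ nothing → Depth F v 1
  child : ∀ {u v k} → parent F v ≡ just u → Depth F u k → Depth F v (suc k)

DepthAtMost : ∀ {M} → Forest M → ℕ → Set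
DepthAtMost {M} F d = (v : Fin M) → ∃[ k ] (k ≤ d × Depth F v k)

ClosureAdj : ∀ {M} → Forest M → Fin M → Fin M → Set
ClosureAdj F a b = a ≢ b × (StrictAnc (parent F) a b ⊎ StrictAnc (parent F) b a)

GuardedBy : ∀ {L N} → Structure L N → Forest N → Set
GuardedBy S F = ∀ a b → GaifmanAdj S a b → ClosureAdj F a b

record Template {L : Language} {n : ℕ} (φ : Formula L n) (k : ℕ) : Set where
  field
    forest : Forest k
    α      : (t : Term L n) → Appears t φ → Fin k
    -- α is a map on the set of terms (independent of the proof of appearance)
    α-wd   : ∀ t (p q : Appears t φ) → α t p ≡ α t q
    leaves : ∀ u → (∀ c → parent forest c ≢ just u) →
             Σ (Term L n) λ t → Σ (Appears t φ) λ p → α t p ≡ u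
open Template public

record Embedding {K M : ℕ} (T : Forest K) (F : Forest M) (ν : Fin K → Fin M) : Set where
  field
    injective   : ∀ u w → ν u ≡ ν w → u ≡ w
    rootsToRoots : ∀ u → parent T u ≡ nothing → parent F (ν u) ≡ nothing
    subforest   : ∀ u y → parent F (ν u) ≡ just y → ∃[ w ] (ν w ≡ y)
    -- ν is an isomorphism of T onto the subforest induced on the image
    arcs⇒       : ∀ u w → parent T u ≡ just w → parent F (ν u) ≡ just (ν w)
    arcs⇐       : ∀ u w → parent F (ν u) ≡ just (ν w) → parent T u ≡ just w

Admissible : ∀ {L n k N} {φ : Formula L n} → (T : Template φ k) → (F : Forest N) →
             (S : Structure L N) → (v : Fin n → Fin N) → (ν : Fin k → Fin N) → Set
Admissible {L} {n} {φ = φ} T F S v ν =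
  Embedding (forest T) F ν ×
  (∀ (t : Term L n) (p : Appears t φ) → ν (α T t p) ≡ eval S v t)

Compatible : ∀ {L n k N} {φ : Formula L n} → Template φ k → Forest N →
             Structure L N → (Fin n → Fin N) → Set
Compatible {k = k} {N} T F S v = Σ (Fin k → Fin N) λ ν → Admissible T F S v ν

-- The template is the subforest of F spanned by the paths from the roots to
-- the values of the terms of φ, and the admissible embedding is its inclusion.
-- That subforest is closed under parents, so it embeds in F and inherits the
-- depth bound; and each of its childless vertices ends one of these paths,
-- hence is the value of a term of φ.
module Submission where

open import Defs
open import Data.Nat using (ℕ; _≤_)
open import Data.Fin using (Fin) renaming (zero to fzero; suc to fsuc; _≟_ to _≟ᶠ_)
open import Data.Product using (Σ; ∃-syntax; _×_; _,_; proj₂)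
open import Data.Sum using (_⊎_; inj₁; inj₂)
open import Data.Maybe using (Maybe; just; nothing)
open import Data.Maybe.Properties using (just-injective)
open import Data.Empty using (⊥-elim)
open import Data.List using (List; []; _∷_; _++_; concatMap; length; lookup; filter; allFin)
open import Data.List.Relation.Unary.Any as Any using (Any; here; there; any?; satisfied)
open import Data.List.Relation.Unary.Any.Properties using (lookup-index)
open import Data.List.Relation.Unary.All as All using ()
open import Data.List.Relation.Unary.AllPairs using (_∷_)
open import Data.List.Relation.Unary.Unique.Propositional using (Unique)
import Data.List.Relation.Unary.Unique.Propositional.Properties as Unique
open import Data.List.Membership.Propositional using (_∈_; find; lose)
open import Data.List.Membership.Propositional.Properties
  using (∈-++⁺ˡ; ∈-++⁺ʳ; ∈-++⁻; ∈-concatMap⁺; ∈-concatMap⁻; ∈-filter⁺; ∈-filter⁻; ∈-allFin; ∈-lookup)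
import Data.List.Membership.DecPropositional as DecMembership
open import Function using (_∘_)
open import Relation.Unary using (Decidable)
import Data.Maybe.Relation.Unary.All as MaybeAll
open import Relation.Binary.PropositionalEquality using (_≡_; _≢_; refl; sym; trans; cong; subst)

lookup-injective : ∀ {A : Set} {xs : List A} → Unique xs →
                   ∀ i j → lookup xs i ≡ lookup xs j → i ≡ j
lookup-injective (_ ∷ _)      fzero    fzero    _  = refl
lookup-injective (x∉ ∷ _)     fzero    (fsuc j) eq = ⊥-elim (All.lookup x∉ (∈-lookup j) eq)
lookup-injective (x∉ ∷ _)     (fsuc i) fzero    eq = ⊥-elim (All.lookup x∉ (∈-lookup i) (sym eq))
lookup-injective (_ ∷ unique) (fsuc i) (fsuc j) eq = cong fsuc (lookup-injective unique i j eq)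

module _ {L : Language} {n : ℕ} where

  subterms : Term L n → List (Term L n)
  subterms (var i)   = var i ∷ []
  subterms (app f t) = app f t ∷ subterms t

  subterms-complete : ∀ {t s} → AppearsInTerm t s → t ∈ subterms s
  subterms-complete {s = var i}   here        = here refl
  subterms-complete {s = app f s} here        = here refl
  subterms-complete               (under f p) = there (subterms-complete p)

  subterms-sound : ∀ {t} s → t ∈ subterms s → AppearsInTerm t s
  subterms-sound (var i)   (here refl) = here
  subterms-sound (app f s) (here refl) = here
  subterms-sound (app f s) (there p)   = under f (subterms-sound s p)

  terms : Formula L n → List (Term L n)
  terms (relF r ts) = concatMap (subterms ∘ ts) (allFin (arity L r))
  terms (eqF s u)   = subterms s ++ subterms u
  terms trueF       = []
  terms falseF      = []
  terms (notF ψ)    = terms ψ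
  terms (andF ψ χ)  = terms ψ ++ terms χ
  terms (orF ψ χ)   = terms ψ ++ terms χ

  terms-complete : ∀ {t φ} → Appears t φ → t ∈ terms φ
  terms-complete (inRel r ts i p) = ∈-concatMap⁺ (subterms ∘ ts) (lose (∈-allFin i) (subterms-complete p))
  terms-complete (inEqˡ s u p)    = ∈-++⁺ˡ (subterms-complete p)
  terms-complete (inEqʳ s u p)    = ∈-++⁺ʳ (subterms s) (subterms-complete p)
  terms-complete (inNot ψ p)      = terms-complete p
  terms-complete (inAndˡ ψ χ p)   = ∈-++⁺ˡ (terms-complete p)
  terms-complete (inAndʳ ψ χ p)   = ∈-++⁺ʳ (terms ψ) (terms-complete p)
  terms-complete (inOrˡ ψ χ p)    = ∈-++⁺ˡ (terms-complete p)
  terms-complete (inOrʳ ψ χ p)    = ∈-++⁺ʳ (terms ψ) (terms-complete p)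

  terms-sound : ∀ {t} φ → t ∈ terms φ → Appears t φ
  terms-sound (relF r ts) p =
    let i , q = satisfied (∈-concatMap⁻ (subterms ∘ ts) {xs = allFin _} p)
    in inRel r ts i (subterms-sound (ts i) q)
  terms-sound (eqF s u) p with ∈-++⁻ (subterms s) p
  ... | inj₁ q = inEqˡ s u (subterms-sound s q)
  ... | inj₂ q = inEqʳ s u (subterms-sound u q)
  terms-sound (notF ψ) p = inNot ψ (terms-sound ψ p)
  terms-sound (andF ψ χ) p with ∈-++⁻ (terms ψ) p
  ... | inj₁ q = inAndˡ ψ χ (terms-sound ψ q)
  ... | inj₂ q = inAndʳ ψ χ (terms-sound χ q)
  terms-sound (orF ψ χ) p with ∈-++⁻ (terms ψ) p
  ... | inj₁ q = inOrˡ ψ χ (terms-sound ψ q)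
  ... | inj₂ q = inOrʳ ψ χ (terms-sound χ q)

module _ {N : ℕ} (F : Forest N) where

  rootPath : ∀ {x k} → Depth F x k → List (Fin N)
  rootPath {x} (root _)    = x ∷ []
  rootPath {x} (child _ d) = x ∷ rootPath d

  rootPath-self : ∀ {x k} (d : Depth F x k) → x ∈ rootPath d
  rootPath-self (root _)    = here refl
  rootPath-self (child _ _) = here refl

  rootPath-parent : ∀ {x k u y} (d : Depth F x k) → u ∈ rootPath d →
                    parent F u ≡ just y → y ∈ rootPath d
  rootPath-parent (root x-root) (here refl) u→y with trans (sym x-root) u→y
  ... | ()
  rootPath-parent (child x→z d) (here refl) u→y with just-injective (trans (sym x→z) u→y)
  ... | refl = there (rootPath-self d)
  rootPath-parent (child _ d) (there p) u→y = there (rootPath-parent d p u→y)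

  rootPath-end⊎child : ∀ {x k u} (d : Depth F x k) → u ∈ rootPath d →
                       u ≡ x ⊎ ∃[ c ] (parent F c ≡ just u × c ∈ rootPath d)
  rootPath-end⊎child (root _)      (here refl) = inj₁ refl
  rootPath-end⊎child (child _ _)   (here refl) = inj₁ refl
  rootPath-end⊎child (child x→u d) (there p) with rootPath-end⊎child d p
  ... | inj₁ refl           = inj₂ (_ , x→u , here refl)
  ... | inj₂ (c , c→u , c∈) = inj₂ (c , c→u , there c∈)

module InducedSubforest {N : ℕ} (F : Forest N) {P : Fin N → Set} (P? : Decidable P)
    (P-closed : ∀ {u y} → P u → parent F u ≡ just y → P y) where

  vertices : List (Fin N)
  vertices = filter P? (allFin N)

  size : ℕ
  size = length vertices

  ι : Fin size → Fin N
  ι = lookup vertices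

  ι-injective : ∀ i j → ι i ≡ ι j → i ≡ j
  ι-injective = lookup-injective (Unique.filter⁺ P? (Unique.allFin⁺ N))

  P-ι : ∀ i → P (ι i)
  P-ι i = proj₂ (∈-filter⁻ P? {xs = allFin N} (∈-lookup i))

  index : ∀ {u} → P u → Fin size
  index p = Any.index (∈-filter⁺ P? (∈-allFin _) p)

  ι-index : ∀ {u} (p : P u) → ι (index p) ≡ u
  ι-index p = sym (lookup-index (∈-filter⁺ P? (∈-allFin _) p))

  P-parent : ∀ {u} → P u → MaybeAll.All P (parent F u)
  P-parent {u} Pu with parent F u in u→y
  ... | nothing = MaybeAll.nothing
  ... | just _  = MaybeAll.just (P-closed Pu u→y)

  private
    restrict : ∀ {m} → MaybeAll.All P m → Maybe (Fin size)
    restrict MaybeAll.nothing   = nothing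
    restrict (MaybeAll.just Py) = just (index Py)

  parentᴵ : Fin size → Maybe (Fin size)
  parentᴵ i = restrict (P-parent (P-ι i))

  parentᴵ-nothing⇒ : ∀ {i} → parentᴵ i ≡ nothing → parent F (ι i) ≡ nothing
  parentᴵ-nothing⇒ {i} = go (P-parent (P-ι i))
    where
    go : ∀ {m} (Pm : MaybeAll.All P m) → restrict Pm ≡ nothing → m ≡ nothing
    go MaybeAll.nothing _ = refl

  parentᴵ-nothing⇐ : ∀ {i} → parent F (ι i) ≡ nothing → parentᴵ i ≡ nothing
  parentᴵ-nothing⇐ {i} = go (P-parent (P-ι i))
    where
    go : ∀ {m} (Pm : MaybeAll.All P m) → m ≡ nothing → restrict Pm ≡ nothing
    go MaybeAll.nothing _ = refl

  parentᴵ-just⇒ : ∀ {i w} → parentᴵ i ≡ just w → parent F (ι i) ≡ just (ι w)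
  parentᴵ-just⇒ {i} = go (P-parent (P-ι i))
    where
    go : ∀ {m w} (Pm : MaybeAll.All P m) → restrict Pm ≡ just w → m ≡ just (ι w)
    go (MaybeAll.just Py) refl = cong just (sym (ι-index Py))

  parentᴵ-just⇐ : ∀ {i w} → parent F (ι i) ≡ just (ι w) → parentᴵ i ≡ just w
  parentᴵ-just⇐ {i} = go (P-parent (P-ι i))
    where
    go : ∀ {m w} (Pm : MaybeAll.All P m) → m ≡ just (ι w) → restrict Pm ≡ just w
    go (MaybeAll.just Py) refl = cong just (ι-injective _ _ (ι-index Py))

  ancestor-ι : ∀ {a b} → StrictAnc parentᴵ a b → StrictAnc (parent F) (ι a) (ι b)
  ancestor-ι (parentOf e) = parentOf (parentᴵ-just⇒ e)
  ancestor-ι (step e a)   = step (parentᴵ-just⇒ e) (ancestor-ι a)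

  subforest : Forest size
  subforest = record { parent = parentᴵ ; acyclic = λ a a<a → acyclic F (ι a) (ancestor-ι a<a) }

  ι-embedding : Embedding subforest F ι
  ι-embedding = record
    { injective    = ι-injective
    ; rootsToRoots = λ _ → parentᴵ-nothing⇒
    ; subforest    = λ u y u→y → index (P-closed (P-ι u) u→y) , ι-index _
    ; arcs⇒        = λ _ _ → parentᴵ-just⇒
    ; arcs⇐        = λ _ _ → parentᴵ-just⇐
    }

  depth-ι : ∀ {x k} → Depth F x k → ∀ i → ι i ≡ x → Depth subforest i k
  depth-ι (root x-root) i refl = root (parentᴵ-nothing⇐ x-root)
  depth-ι (child x→y d) i refl =
    child (parentᴵ-just⇐ (trans x→y (cong just (sym (ι-index Py))))) (depth-ι d (index Py) (ι-index Py))
    where Py = P-closed (P-ι i) x→y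

  subforest-depthAtMost : ∀ {d} → DepthAtMost F d → DepthAtMost subforest d
  subforest-depthAtMost F≤d i = let k , k≤d , dᵢ = F≤d (ι i) in k , k≤d , depth-ι dᵢ i refl

  childless-ι : ∀ {i} → (∀ c → parentᴵ c ≢ just i) → ∀ {c} → P c → parent F c ≢ just (ι i)
  childless-ι no-child Pc c→i =
    no-child (index Pc) (parentᴵ-just⇐ (subst (λ z → parent F z ≡ just _) (sym (ι-index Pc)) c→i))

module RootPathTemplate {N : ℕ} (F : Forest N) (depth : ∀ x → ∃[ k ] Depth F x k)
    {L : Language} {n : ℕ} (φ : Formula L n) (S : Structure L N) (v : Fin n → Fin N) where

  open DecMembership (_≟ᶠ_ {N}) using (_∈?_)

  path : Term L n → List (Fin N)
  path t = rootPath F (proj₂ (depth (eval S v t)))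

  OnPath : Fin N → Set
  OnPath u = Any (λ t → u ∈ path t) (terms φ)

  OnPath? : Decidable OnPath
  OnPath? u = any? (λ t → u ∈? path t) (terms φ)

  OnPath-closed : ∀ {u y} → OnPath u → parent F u ≡ just y → OnPath y
  OnPath-closed u∈ u→y = Any.map (λ u∈t → rootPath-parent F _ u∈t u→y) u∈

  open InducedSubforest F OnPath? OnPath-closed public

  value-OnPath : ∀ {t} → Appears t φ → OnPath (eval S v t)
  value-OnPath t∈φ = lose (terms-complete t∈φ) (rootPath-self F _)

  α-path : (t : Term L n) → Appears t φ → Fin size
  α-path t t∈φ = index (value-OnPath t∈φ)

  childless-value : ∀ i → (∀ c → parentᴵ c ≢ just i) →
                    Σ (Term L n) λ t → Σ (Appears t φ) λ t∈φ → α-path t t∈φ ≡ i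
  childless-value i no-child with find (P-ι i)
  ... | t , t∈φ , i∈t with rootPath-end⊎child F _ i∈t
  ...   | inj₁ i≡t = t , terms-sound φ t∈φ , ι-injective _ _ (trans (ι-index _) (sym i≡t))
  ...   | inj₂ (c , c→i , c∈t) = ⊥-elim (childless-ι no-child (lose t∈φ c∈t) c→i)

  template : Template φ size
  template = record
    { forest = subforest
    ; α      = α-path
    ; α-wd   = λ t p q → ι-injective _ _ (trans (ι-index _) (sym (ι-index _)))
    ; leaves = childless-value
    }

  compatible : Compatible template F S v
  compatible = ι , ι-embedding , λ t t∈φ → ι-index (value-OnPath t∈φ)

lemma14 : (d : ℕ) → 1 ≤ d → {N : ℕ} → (F : Forest N) → DepthAtMost F d →
          (L : Language) → {n : ℕ} → (φ : Formula L n) →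
          (S : Structure L N) → GuardedBy S F →
          (v : Fin n → Fin N) →
          ∃[ k ] Σ (Template φ k) λ T → DepthAtMost (forest T) d × Compatible T F S v
lemma14 d _ F F≤d L φ S _ v = size , template , subforest-depthAtMost F≤d , compatible
  where open RootPathTemplate F (λ x → _ , proj₂ (proj₂ (F≤d x))) φ S v
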